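{- Let $X$ be a stable graph of order $n$ and let $u,v$ lie in the same cell of $X$. Let $\bar X$ be the graph obtained from $X$ by exchanging rows $u$ and $v$ and simultaneously exchanging columns $u$ and $v$ (i.e. $\bar X=PXP^\top$ for the permutation matrix $P$ of the transposition $(u\,v)$). Then $\bar X$ is similar to $X$.
   Context: Labeled graphs: $\mathrm{Var}$ is an infinite set of independent variables and $x_0\notin\mathrm{Var}$ a reserved symbol. A labeled graph of order $n$ is an $n\times n$ matrix $G=(g_{ij})$ with entries in $\{x_0\}\cup\mathrm{Var}$; $g_{ii}$ is the label of vertex $i$. Diamond product: $(G\diamond G)_{ij}=\{\!\{(g_{ik},g_{kj}):k\in[n]\}\!\}$. $\mathrm{evs}(A)$ replaces entries of $A$ by variables of $\mathrm{Var}$ so that equal entries get equal variables and distinct entries distinct ones. $A\ge B$ means $b_{uv}=b_{st}\Rightarrow a_{uv}=a_{st}$; $A\approx B$ means $A\ge B$ and $B\ge A$. A stable graph is a graph $X$ with $x_{ii}\ne x_{uv}$ for all $i$ and $u\ne v$ and $\mathrm{evs}(X\diamond X)\approx X$. A cell is a maximal set of vertices with equal diagonal labels. Similarity: stable graphs $X,\bar X$ of order $n$ with the same cell partition are similar if (i) for every $i$, $\{\!\{x_{ik}:k\}\!\}=\{\!\{\bar x_{ik}:k\}\!\}$ and $\{\!\{x_{ki}:k\}\!\}=\{\!\{\bar x_{ki}:k\}\!\}$; (ii) for all $u,v,r,s$, $x_{uv}=\bar x_{rs}$ iff $\{\!\{(x_{uk},x_{kv}):k\}\!\}=\{\!\{(\bar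 x_{rk},\bar x_{ks}):k\}\!\}$. -}

module Defs where

open import Data.Nat using (ℕ)
open import Data.Fin using (Fin)
open import Data.List using (List; map; allFin)
open import Data.Product using (_×_; _,_; ∃)
open import Data.Maybe using (Maybe; just; nothing)
open import Relation.Binary.PropositionalEquality using (_≡_; _≢_)
open import Data.List.Relation.Binary.Permutation.Propositional using (_↭_)
open import Function.Bundles using (_⇔_)
import Data.Fin.Permutation.Components as PC

-- Var is modelled by ℕ (an infinite set of variables); the reserved
-- symbol x₀ ∉ Var is 'nothing', a variable v ∈ Var is 'just v'.
Var : Set
Var = ℕ

Label : Set
Label = Maybe Var

x₀ : Label
x₀ = nothing

Graph : ℕ → Set
Graph n = Fin n → Fin n → Label

Matrix : Set → ℕ → Set
Matrix A n = Fin n → Fin n → A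

-- Multisets over a finite index set: the multiset {{ f k : k ∈ [n] }} is
-- represented by the list  map f (allFin n), and multiset equality is
-- equality up to permutation (_↭_).
Multiset : Set → Set
Multiset A = List A

msOf : ∀ {A : Set} {n : ℕ} → (Fin n → A) → Multiset A
msOf {n = n} f = map f (allFin n)

_◇_ : ∀ {n} → Graph n → Graph n → Matrix (Multiset (Label × Label)) n
(G ◇ H) i j = msOf (λ k → (G i k , H k j))

_≋_ : Multiset (Label × Label) → Multiset (Label × Label) → Set
_≋_ = _↭_

_≥G_ : ∀ {n} → Graph n → Graph n → Set
_≥G_ {n} A B = ∀ (u v s t : Fin n) → B u v ≡ B s t → A u v ≡ A s t

_≈G_ : ∀ {n} → Graph n → Graph n → Set
A ≈G B = (A ≥G B) × (B ≥G A)

IsEvs : ∀ {n} → Matrix (Multiset (Label × Label)) n → Graph n → Set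
IsEvs {n} A E =
  (∃ λ (e : Matrix Var n) → ∀ i j → E i j ≡ just (e i j)) ×
  (∀ (u v s t : Fin n) → (A u v ≋ A s t) ⇔ (E u v ≡ E s t))

Stable : ∀ {n} → Graph n → Set
Stable {n} X =
  (∀ (i u v : Fin n) → u ≢ v → X i i ≢ X u v) ×
  (∃ λ (E : Graph n) → IsEvs (X ◇ X) E × (E ≈G X))

SameCell : ∀ {n} → Graph n → Fin n → Fin n → Set
SameCell X u v = X u u ≡ X v v

SameCells : ∀ {n} → Graph n → Graph n → Set
SameCells {n} X Y = ∀ (i j : Fin n) → SameCell X i j ⇔ SameCell Y i j

-- Similarity of stable graphs (the definition presupposes both are
-- stable with the same cell partition; we include these as conjuncts).
Similar : ∀ {n} → Graph n → Graph n → Set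
Similar {n} X Y =
  Stable X × Stable Y × SameCells X Y ×
  (∀ (i : Fin n) → (msOf (λ k → X i k) ↭ msOf (λ k → Y i k))
                 × (msOf (λ k → X k i) ↭ msOf (λ k → Y k i))) ×
  (∀ (u v r s : Fin n) → (X u v ≡ Y r s) ⇔ ((X ◇ X) u v ≋ (Y ◇ Y) r s))

swapGraph : ∀ {n} → Fin n → Fin n → Graph n → Graph n
swapGraph u v X i j = X (PC.transpose u v i) (PC.transpose u v j)

-- Relabelling the vertices of a graph by a permutation π permutes the
-- index set of every multiset in the definition of similarity, so the
-- relabelled graph is again stable and its diamond-product entries are
-- those of X at (π a, π b). Similarity then only needs that π maps every
-- vertex into its own cell: in a stable graph, x_aa = x_bb forces
-- (X ◇ X)_aa = (X ◇ X)_bb, whose first and second projections are the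
-- row and column multisets of a and b.
module Submission where

open import Defs
open import Data.Nat using (ℕ)
open import Data.Fin using (Fin)
open import Data.Fin.Properties using (_≟_)
open import Data.Fin.Permutation using (Permutation′; _⟨$⟩ʳ_; _⟨$⟩ˡ_; inverseˡ; inverseʳ; transpose)
open import Data.Product using (_×_; _,_; proj₁; proj₂)
open import Data.List using (List; map; allFin)
open import Data.List.Properties using (map-∘)
open import Data.List.Membership.Propositional using (_∈_)
open import Data.List.Membership.Propositional.Properties using (∈-allFin; ∈-map⁺)
open import Data.List.Membership.Propositional.Properties.WithK using (unique∧set⇒bag)
open import Data.List.Relation.Binary.BagAndSetEquality using (∼bag⇒↭)
open import Data.List.Relation.Binary.Permutation.Propositional using (_↭_; ↭-refl; ↭-sym; ↭-trans; ↭-reflexive)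
open import Data.List.Relation.Binary.Permutation.Propositional.Properties using (map⁺)
open import Data.List.Relation.Unary.Unique.Propositional.Properties using (allFin⁺)
import Data.List.Relation.Unary.Unique.Propositional.Properties as Unique
open import Function.Base using (_∘_)
open import Function.Bundles using (_⇔_; mk⇔; Equivalence)
open import Function.Construct.Composition using (_⇔-∘_)
open import Relation.Binary.PropositionalEquality using (_≡_; refl; sym; trans; cong; subst)
open import Relation.Nullary using (yes; no)

open Equivalence using (to; from)

private
  variable
    n : ℕ
    A : Set

permutation-injective : (π : Permutation′ n) {a b : Fin n} → π ⟨$⟩ʳ a ≡ π ⟨$⟩ʳ b → a ≡ b
permutation-injective π {a} {b} eq =
  trans (sym (inverseˡ π)) (trans (cong (π ⟨$⟩ˡ_) eq) (inverseˡ π))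

map-permutation-allFin : (π : Permutation′ n) → map (π ⟨$⟩ʳ_) (allFin n) ↭ allFin n
map-permutation-allFin {n} π =
  ∼bag⇒↭ (unique∧set⇒bag (Unique.map⁺ (permutation-injective π) (allFin⁺ n)) (allFin⁺ n)
    (λ {i} → mk⇔ (λ _ → ∈-allFin i) (λ _ → hit i)))
  where
  hit : ∀ i → i ∈ map (π ⟨$⟩ʳ_) (allFin n)
  hit i = subst (_∈ map (π ⟨$⟩ʳ_) (allFin n)) (inverseʳ π) (∈-map⁺ (π ⟨$⟩ʳ_) (∈-allFin (π ⟨$⟩ˡ i)))

msOf-permute : (π : Permutation′ n) (f : Fin n → A) → msOf (f ∘ (π ⟨$⟩ʳ_)) ↭ msOf f
msOf-permute {n} π f = ↭-trans (↭-reflexive (map-∘ (allFin n))) (map⁺ f (map-permutation-allFin π))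

↭-cong-⇔ : {xs xs′ ys ys′ : List A} → xs ↭ xs′ → ys ↭ ys′ → (xs ↭ ys) ⇔ (xs′ ↭ ys′)
↭-cong-⇔ p q = mk⇔ (λ h → ↭-trans (↭-sym p) (↭-trans h q))
                   (λ h → ↭-trans p (↭-trans h (↭-sym q)))

relabel : Permutation′ n → Graph n → Graph n
relabel π X i j = X (π ⟨$⟩ʳ i) (π ⟨$⟩ʳ j)

◇-relabel : (π : Permutation′ n) (X : Graph n) (a b : Fin n) →
            (relabel π X ◇ relabel π X) a b ↭ (X ◇ X) (π ⟨$⟩ʳ a) (π ⟨$⟩ʳ b)
◇-relabel π X a b = msOf-permute π (λ k → X (π ⟨$⟩ʳ a) k , X k (π ⟨$⟩ʳ b))

◇-relabel-↭⇔ : (π : Permutation′ n) (X : Graph n) (a b c d : Fin n) →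
               ((relabel π X ◇ relabel π X) a b ↭ (relabel π X ◇ relabel π X) c d)
               ⇔ ((X ◇ X) (π ⟨$⟩ʳ a) (π ⟨$⟩ʳ b) ↭ (X ◇ X) (π ⟨$⟩ʳ c) (π ⟨$⟩ʳ d))
◇-relabel-↭⇔ π X a b c d = ↭-cong-⇔ (◇-relabel π X a b) (◇-relabel π X c d)

stable-≡⇔◇↭ : {X : Graph n} → Stable X →
              ∀ a b c d → (X a b ≡ X c d) ⇔ ((X ◇ X) a b ↭ (X ◇ X) c d)
stable-≡⇔◇↭ (_ , _ , (_ , evs) , E≥X , X≥E) a b c d =
  mk⇔ (from (evs a b c d) ∘ E≥X a b c d) (X≥E a b c d ∘ to (evs a b c d))

stable-relabel : (π : Permutation′ n) {X : Graph n} → Stable X → Stable (relabel π X)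
stable-relabel π {X} (diagonal-distinct , E , ((e , E≡e) , evs) , E≥X , X≥E) =
  (λ i a b a≢b → diagonal-distinct (π′ i) (π′ a) (π′ b) (a≢b ∘ permutation-injective π))
  , relabel π E
  , (((λ i j → e (π′ i) (π′ j)) , (λ i j → E≡e (π′ i) (π′ j)))
    , (λ a b c d → evs (π′ a) (π′ b) (π′ c) (π′ d) ⇔-∘ ◇-relabel-↭⇔ π X a b c d))
  , (λ a b c d → E≥X (π′ a) (π′ b) (π′ c) (π′ d))
  , (λ a b c d → X≥E (π′ a) (π′ b) (π′ c) (π′ d))
  where
  π′ = π ⟨$⟩ʳ_

map-proj₁-◇ : (X Y : Graph n) (a b : Fin n) → map proj₁ ((X ◇ Y) a b) ≡ msOf (X a)
map-proj₁-◇ {n} X Y a b = sym (map-∘ (allFin n))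

map-proj₂-◇ : (X Y : Graph n) (a b : Fin n) → map proj₂ ((X ◇ Y) a b) ≡ msOf (λ k → Y k b)
map-proj₂-◇ {n} X Y a b = sym (map-∘ (allFin n))

module _ {X : Graph n} (stable : Stable X) {a b : Fin n} (cell : SameCell X a b) where

  private
    ◇-diagonal : (X ◇ X) a a ↭ (X ◇ X) b b
    ◇-diagonal = to (stable-≡⇔◇↭ stable a a b b) cell

  sameCell⇒row-↭ : msOf (X a) ↭ msOf (X b)
  sameCell⇒row-↭ = to (↭-cong-⇔ (↭-reflexive (map-proj₁-◇ X X a a)) (↭-reflexive (map-proj₁-◇ X X b b)))
                      (map⁺ proj₁ ◇-diagonal)

  sameCell⇒column-↭ : msOf (λ k → X k a) ↭ msOf (λ k → X k b)
  sameCell⇒column-↭ = to (↭-cong-⇔ (↭-reflexive (map-proj₂-◇ X X a a)) (↭-reflexive (map-proj₂-◇ X X b b)))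
                         (map⁺ proj₂ ◇-diagonal)

relabel-similar : (π : Permutation′ n) {X : Graph n} → Stable X →
                  (∀ i → SameCell X (π ⟨$⟩ʳ i) i) → Similar X (relabel π X)
relabel-similar π {X} stable cell-preserving =
  stable , stable-relabel π stable , cells , degrees , entries
  where
  π′ = π ⟨$⟩ʳ_

  cells : SameCells X (relabel π X)
  cells i j = mk⇔ (λ h → trans (cell-preserving i) (trans h (sym (cell-preserving j))))
                  (λ h → trans (sym (cell-preserving i)) (trans h (cell-preserving j)))

  degrees : ∀ i → (msOf (X i) ↭ msOf (relabel π X i))
                × (msOf (λ k → X k i) ↭ msOf (λ k → relabel π X k i))
  degrees i =
    ↭-trans (sameCell⇒row-↭ stable (sym (cell-preserving i))) (↭-sym (msOf-permute π (X (π′ i))))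
    , ↭-trans (sameCell⇒column-↭ stable (sym (cell-preserving i))) (↭-sym (msOf-permute π (λ k → X k (π′ i))))

  entries : ∀ a b r s → (X a b ≡ relabel π X r s) ⇔ ((X ◇ X) a b ≋ (relabel π X ◇ relabel π X) r s)
  entries a b r s = ↭-cong-⇔ ↭-refl (↭-sym (◇-relabel π X r s))
                    ⇔-∘ stable-≡⇔◇↭ stable a b (π′ r) (π′ s)

transpose-sameCell : (X : Graph n) {u v : Fin n} → SameCell X u v →
                     ∀ k → SameCell X (transpose u v ⟨$⟩ʳ k) k
transpose-sameCell X {u} {v} cell k with k ≟ u
... | yes refl = sym cell
... | no _ with k ≟ v
...   | yes refl = cell
...   | no _ = refl

proposition3p9 : (n : ℕ) (X : Graph n) (u v : Fin n) →
                 Stable X → SameCell X u v →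
                 Similar X (swapGraph u v X)
proposition3p9 n X u v stable cell =
  relabel-similar (transpose u v) stable (transpose-sameCell X cell)
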